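{- Let $\mathbb{F}$ be a field with $\operatorname{char}(\mathbb{F})\neq2$, $M\in\mathbb{F}^2$ and $r\in\mathbb{F}^{*}$. If there is a circular point set contained in $C(M,r)_{\mathbb{F}}$ of cardinality at least $3$, then $r^2\in\boldsymbol{P}(\mathbb{F})$.
   Context: $\boldsymbol{P}(\mathbb{F})$ is the prime subfield of $\mathbb{F}$, $\square_K=\{a^2:a\in K\}$. $C(M,r)_{\mathbb{F}}=\{(x,y)\in\mathbb{F}^2:(x-m_1)^2+(y-m_2)^2=r^2\}$ for $M=(m_1,m_2)$. $D^2((p_1,p_2),(q_1,q_2))=(p_1-q_1)^2+(p_2-q_2)^2$. A circular point set contained in $C(M,r)_{\mathbb{F}}$ is a subset $S\subseteq C(M,r)_{\mathbb{F}}$ such that $D^2(P,Q)\in\square_{\boldsymbol{P}(\mathbb{F})}$ for all $P,Q\in S$. -}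

module Defs where

open import Level using (Level; _⊔_; suc)
open import Algebra.Bundles using (CommutativeRing)
open import Data.Product using (Σ; ∃; _×_; _,_)
open import Data.Nat as ℕ using (ℕ)
open import Data.Integer as ℤ using (ℤ; +_; -[1+_])
open import Relation.Nullary using (¬_)

record Field (c ℓ : Level) : Set (suc (c ⊔ ℓ)) where
  field
    commutativeRing : CommutativeRing c ℓ
  open CommutativeRing commutativeRing public
  field
    1≉0     : ¬ (1# ≈ 0#)
    inverse : ∀ x → ¬ (x ≈ 0#) → ∃ λ y → x * y ≈ 1#

module FieldNotions {c ℓ : Level} (F : Field c ℓ) where
  open Field F public

  natCast : ℕ → Carrier
  natCast ℕ.zero    = 0#
  natCast (ℕ.suc n) = 1# + natCast n

  intCast : ℤ → Carrier
  intCast (+ n)     = natCast n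
  intCast -[1+ n ]  = - natCast (ℕ.suc n)

  CharNot2 : Set ℓ
  CharNot2 = ¬ ((1# + 1#) ≈ 0#)

  -- membership in the prime subfield P(F) = { a·1 / b·1 : a, b ∈ ℤ, b·1 ≠ 0 }
  InPrimeSubfield : Carrier → Set ℓ
  InPrimeSubfield x = Σ ℤ λ a → Σ ℤ λ b → ¬ (intCast b ≈ 0#) × (x * intCast b ≈ intCast a)

  InSquaresOfPrimeSubfield : Carrier → Set (c ⊔ ℓ)
  InSquaresOfPrimeSubfield x = Σ Carrier λ t → InPrimeSubfield t × (x ≈ t * t)

  Point : Set c
  Point = Carrier × Carrier

  _≈ᴾ_ : Point → Point → Set ℓ
  (p₁ , p₂) ≈ᴾ (q₁ , q₂) = (p₁ ≈ q₁) × (p₂ ≈ q₂)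

  D² : Point → Point → Carrier
  D² (p₁ , p₂) (q₁ , q₂) = (p₁ - q₁) * (p₁ - q₁) + (p₂ - q₂) * (p₂ - q₂)

  OnCircle : Point → Carrier → Point → Set ℓ
  OnCircle (m₁ , m₂) r (x , y) = (x - m₁) * (x - m₁) + (y - m₂) * (y - m₂) ≈ r * r

  CircularPointSetIn : ∀ {s} → Point → Carrier → (Point → Set s) → Set (c ⊔ ℓ ⊔ s)
  CircularPointSetIn M r S =
    (∀ P → S P → OnCircle M r P) ×
    (∀ P Q → S P → S Q → InSquaresOfPrimeSubfield (D² P Q))

  HasAtLeast3 : ∀ {s} → (Point → Set s) → Set (c ⊔ ℓ ⊔ s)
  HasAtLeast3 S = Σ Point λ P → Σ Point λ Q → Σ Point λ R →
    S P × S Q × S R × ¬ (P ≈ᴾ Q) × ¬ (P ≈ᴾ R) × ¬ (Q ≈ᴾ R)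

-- Let A, B, C be the squared sides of a triangle PQR inscribed in the circle with centre M and
-- radius r, and Δ(A,B,C) = 2AB + 2BC + 2CA − A² − B² − C² (sixteen times the squared area, by
-- Heron). The circumradius formula in the division-free form r² · Δ(A,B,C) = A·B·C follows from
-- the chord relation C = 2⟨P − R, M − R⟩ and Lagrange-type identities. For a circular point set
-- A, B, C lie in the prime subfield, hence so does r² = ABC / Δ(A,B,C), provided Δ(A,B,C) ≠ 0.
-- If Δ(A,B,C) = 0 then some side, say A, vanishes; then Δ(0,B,C) = −(B − C)² forces B = C, so
-- P − Q is an isotropic vector orthogonal to the anisotropic vector R − M, hence P = Q.

module Submission where

open import Defs
open import Level using (Level; _⊔_; 0ℓ)
open import Algebra.Bundles.Raw using (RawRing)
open import Data.Nat as ℕ using (ℕ; zero; suc)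
open import Data.Integer as ℤ using (ℤ; +_; -[1+_]; +[1+_])
import Data.Integer.Properties as ℤ
import Data.Nat.Properties as ℕ
open import Data.Maybe using (Maybe; just; nothing)
open import Data.Product using (Σ; _×_; _,_)
open import Relation.Nullary using (¬_; yes; no)
open import Relation.Binary.PropositionalEquality as ≡ using (_≡_)
import Algebra.Solver.Ring
open import Algebra.Solver.Ring.AlmostCommutativeRing
  using (fromCommutativeRing; _-Raw-AlmostCommutative⟶_)

-- Stated over a raw ring so that they can be instantiated both at a field, where D² is
-- definitionally the D² of Defs, and at the ring solver's polynomial expressions.
module PlaneFormulas {a ℓ} (R : RawRing a ℓ) where
  open RawRing R

  infixl 6 _-_ _-ᵥ_
  infixr 7 _·ᵥ_
  infix 8 _²

  _-_ : Carrier → Carrier → Carrier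
  x - y = x + - y

  _² : Carrier → Carrier
  x ² = x * x

  double : Carrier → Carrier
  double x = x + x

  _-ᵥ_ : Carrier × Carrier → Carrier × Carrier → Carrier × Carrier
  (x₁ , x₂) -ᵥ (y₁ , y₂) = x₁ - y₁ , x₂ - y₂

  _·ᵥ_ : Carrier → Carrier × Carrier → Carrier × Carrier
  s ·ᵥ (x₁ , x₂) = s * x₁ , s * x₂

  ⟪_,_⟫ : Carrier × Carrier → Carrier × Carrier → Carrier
  ⟪ (x₁ , x₂) , (y₁ , y₂) ⟫ = x₁ * y₁ + x₂ * y₂

  ‖_‖² : Carrier × Carrier → Carrier
  ‖ x ‖² = ⟪ x , x ⟫

  D² : Carrier × Carrier → Carrier × Carrier → Carrier
  D² P Q = ‖ P -ᵥ Q ‖²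

  cross : Carrier × Carrier → Carrier × Carrier → Carrier
  cross (x₁ , x₂) (y₁ , y₂) = x₁ * y₂ - x₂ * y₁

  Δ : Carrier → Carrier → Carrier → Carrier
  Δ a b c = double (a * b) + double (b * c) + double (c * a) - a ² - b ² - c ²

module FieldProperties {c ℓ} (F : Field c ℓ) where
  open FieldNotions F
  open import Relation.Binary.Reasoning.Setoid setoid

  x≉0⇒x*y≈0⇒y≈0 : ∀ {x y} → ¬ x ≈ 0# → x * y ≈ 0# → y ≈ 0#
  x≉0⇒x*y≈0⇒y≈0 {x} {y} x≉0 xy≈0 with inverse x x≉0
  ... | x⁻¹ , xx⁻¹≈1 = begin
    y               ≈⟨ *-identityˡ y ⟨
    1# * y          ≈⟨ *-congʳ (trans (*-comm x⁻¹ x) xx⁻¹≈1) ⟨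
    x⁻¹ * x * y     ≈⟨ *-assoc x⁻¹ x y ⟩
    x⁻¹ * (x * y)   ≈⟨ *-congˡ xy≈0 ⟩
    x⁻¹ * 0#        ≈⟨ zeroʳ x⁻¹ ⟩
    0#              ∎

  x≉0∧y≉0⇒x*y≉0 : ∀ {x y} → ¬ x ≈ 0# → ¬ y ≈ 0# → ¬ x * y ≈ 0#
  x≉0∧y≉0⇒x*y≉0 x≉0 y≉0 xy≈0 = y≉0 (x≉0⇒x*y≈0⇒y≈0 x≉0 xy≈0)

  x*x≈0⇒¬¬x≈0 : ∀ {x} → x * x ≈ 0# → ¬ ¬ x ≈ 0#
  x*x≈0⇒¬¬x≈0 xx≈0 x≉0 = x≉0∧y≉0⇒x*y≉0 x≉0 x≉0 xx≈0

  x+x≈0⇒x≈0 : CharNot2 → ∀ {x} → x + x ≈ 0# → x ≈ 0#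
  x+x≈0⇒x≈0 char≢2 {x} x+x≈0 = x≉0⇒x*y≈0⇒y≈0 char≢2 (begin
    (1# + 1#) * x       ≈⟨ distribʳ x 1# 1# ⟩
    1# * x + 1# * x     ≈⟨ +-cong (*-identityˡ x) (*-identityˡ x) ⟩
    x + x               ≈⟨ x+x≈0 ⟩
    0#                  ∎)

module IntegerCast {c ℓ} (F : Field c ℓ) where
  open FieldNotions F
  open import Relation.Binary.Reasoning.Setoid setoid
  open import Algebra.Properties.Ring ring using (-0#≈0#; -‿involutive; -‿+-comm; -‿distribˡ-*; -‿distribʳ-*)
  open import Algebra.Properties.Semiring.Mult semiring using (×-homo-+; ×1-homo-*)
    renaming (_×_ to _×ₙ_)
  open import Algebra.Properties.CommutativeSemigroup +-commutativeSemigroup using (interchange)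

  natCast≈×1# : ∀ n → natCast n ≈ n ×ₙ 1#
  natCast≈×1# zero    = refl
  natCast≈×1# (suc n) = +-congˡ (natCast≈×1# n)

  natCast-+ : ∀ m n → natCast (m ℕ.+ n) ≈ natCast m + natCast n
  natCast-+ m n = begin
    natCast (m ℕ.+ n)       ≈⟨ natCast≈×1# (m ℕ.+ n) ⟩
    (m ℕ.+ n) ×ₙ 1#          ≈⟨ ×-homo-+ 1# m n ⟩
    m ×ₙ 1# + n ×ₙ 1#         ≈⟨ +-cong (natCast≈×1# m) (natCast≈×1# n) ⟨
    natCast m + natCast n   ∎

  natCast-* : ∀ m n → natCast (m ℕ.* n) ≈ natCast m * natCast n
  natCast-* m n = begin
    natCast (m ℕ.* n)       ≈⟨ natCast≈×1# (m ℕ.* n) ⟩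
    (m ℕ.* n) ×ₙ 1#          ≈⟨ ×1-homo-* m n ⟩
    m ×ₙ 1# * n ×ₙ 1#         ≈⟨ *-cong (natCast≈×1# m) (natCast≈×1# n) ⟨
    natCast m * natCast n   ∎

  intCast-⊖ : ∀ m n → intCast (m ℤ.⊖ n) ≈ natCast m - natCast n
  intCast-⊖ zero    zero    = sym (-‿inverseʳ 0#)
  intCast-⊖ zero    (suc n) = sym (+-identityˡ _)
  intCast-⊖ (suc m) zero    = sym (trans (+-congˡ -0#≈0#) (+-identityʳ _))
  intCast-⊖ (suc m) (suc n) = begin
    intCast (suc m ℤ.⊖ suc n)              ≡⟨ ≡.cong intCast (ℤ.[1+m]⊖[1+n]≡m⊖n m n) ⟩
    intCast (m ℤ.⊖ n)                      ≈⟨ intCast-⊖ m n ⟩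
    natCast m - natCast n                  ≈⟨ +-identityˡ _ ⟨
    0# + (natCast m - natCast n)           ≈⟨ +-congʳ (-‿inverseʳ 1#) ⟨
    (1# - 1#) + (natCast m - natCast n)    ≈⟨ interchange 1# (- 1#) (natCast m) (- natCast n) ⟩
    natCast (suc m) + (- 1# - natCast n)   ≈⟨ +-congˡ (-‿+-comm 1# (natCast n)) ⟩
    natCast (suc m) - natCast (suc n)      ∎

  intCast-+ : ∀ i j → intCast (i ℤ.+ j) ≈ intCast i + intCast j
  intCast-+ (+ m)    (+ n)    = natCast-+ m n
  intCast-+ (+ m)    -[1+ n ] = intCast-⊖ m (suc n)
  intCast-+ -[1+ m ] (+ n)    = trans (intCast-⊖ n (suc m)) (+-comm _ _)
  intCast-+ -[1+ m ] -[1+ n ] = begin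
    - natCast (suc (suc (m ℕ.+ n)))         ≡⟨ ≡.cong (λ k → - natCast (suc k)) (ℕ.+-suc m n) ⟨
    - natCast (suc m ℕ.+ suc n)             ≈⟨ -‿cong (natCast-+ (suc m) (suc n)) ⟩
    - (natCast (suc m) + natCast (suc n))   ≈⟨ -‿+-comm _ _ ⟨
    - natCast (suc m) - natCast (suc n)     ∎

  intCast-neg : ∀ i → intCast (ℤ.- i) ≈ - intCast i
  intCast-neg (+ zero)  = sym -0#≈0#
  intCast-neg +[1+ n ]  = refl
  intCast-neg -[1+ n ]  = sym (-‿involutive _)

  intCast-+* : ∀ m j → intCast (+ m ℤ.* j) ≈ natCast m * intCast j
  intCast-+* m (+ n) = begin
    intCast (+ m ℤ.* + n)   ≡⟨ ≡.cong intCast (ℤ.pos-* m n) ⟨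
    natCast (m ℕ.* n)       ≈⟨ natCast-* m n ⟩
    natCast m * natCast n   ∎
  intCast-+* m -[1+ n ] = begin
    intCast (+ m ℤ.* -[1+ n ])          ≡⟨ ≡.cong intCast (ℤ.neg-distribʳ-* (+ m) +[1+ n ]) ⟨
    intCast (ℤ.- (+ m ℤ.* +[1+ n ]))    ≈⟨ intCast-neg (+ m ℤ.* +[1+ n ]) ⟩
    - intCast (+ m ℤ.* +[1+ n ])        ≈⟨ -‿cong (intCast-+* m +[1+ n ]) ⟩
    - (natCast m * natCast (suc n))     ≈⟨ -‿distribʳ-* _ _ ⟩
    natCast m * - natCast (suc n)       ∎

  intCast-* : ∀ i j → intCast (i ℤ.* j) ≈ intCast i * intCast j
  intCast-* (+ m)    j = intCast-+* m j
  intCast-* -[1+ m ] j = begin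
    intCast (-[1+ m ] ℤ.* j)            ≡⟨ ≡.cong intCast (ℤ.neg-distribˡ-* +[1+ m ] j) ⟨
    intCast (ℤ.- (+[1+ m ] ℤ.* j))      ≈⟨ intCast-neg (+[1+ m ] ℤ.* j) ⟩
    - intCast (+[1+ m ] ℤ.* j)          ≈⟨ -‿cong (intCast-+* (suc m) j) ⟩
    - (natCast (suc m) * intCast j)     ≈⟨ -‿distribˡ-* _ _ ⟩
    - natCast (suc m) * intCast j       ∎

  intCast-homomorphism : ℤ.+-*-rawRing -Raw-AlmostCommutative⟶ fromCommutativeRing commutativeRing
  intCast-homomorphism = record
    { ⟦_⟧ = intCast ; +-homo = intCast-+ ; *-homo = intCast-* ; -‿homo = intCast-neg
    ; 0-homo = refl ; 1-homo = +-identityʳ 1# }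

module RingSolver {c ℓ} (F : Field c ℓ) where
  open FieldNotions F
  open IntegerCast F using (intCast-homomorphism)

  integerCoefficientsEqual? : ∀ i j → Maybe (intCast i ≈ intCast j)
  integerCoefficientsEqual? i j with i ℤ.≟ j
  ... | yes i≡j = just (reflexive (≡.cong intCast i≡j))
  ... | no _    = nothing

  open Algebra.Solver.Ring ℤ.+-*-rawRing (fromCommutativeRing commutativeRing) intCast-homomorphism integerCoefficientsEqual?
    public using (solve; _:=_; Polynomial; _:+_; _:*_; _:-_; :-_; con)

  polynomialRing : ℕ → RawRing 0ℓ 0ℓ
  polynomialRing n = record
    { Carrier = Polynomial n ; _≈_ = _≡_ ; _+_ = _:+_ ; _*_ = _:*_ ; -_ = :-_
    ; 0# = con (+ 0) ; 1# = con (+ 1) }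

  -- _:*_ and Poly._² both have precedence 8, so squares next to _:*_ need parentheses.
  module Poly {n : ℕ} = PlaneFormulas (polynomialRing n)

module CircleGeometry {c ℓ} (F : Field c ℓ) where
  open FieldNotions F hiding (D²)
  open FieldProperties F
  open RingSolver F
  open PlaneFormulas rawRing public hiding (_-_)
  open import Relation.Binary.Reasoning.Setoid setoid
  open import Algebra.Properties.Ring ring using (-0#≈0#; +-cancelʳ; +-identityʳ-unique; x∙y⁻¹≈ε⇒x≈y)

  D²-comm : ∀ P Q → D² P Q ≈ D² Q P
  D²-comm (p₁ , p₂) (q₁ , q₂) = solve 4 (λ p₁ p₂ q₁ q₂ →
    Poly.D² (p₁ , p₂) (q₁ , q₂) := Poly.D² (q₁ , q₂) (p₁ , p₂)) refl p₁ p₂ q₁ q₂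

  chord-identity : ∀ P R M → double ⟪ P -ᵥ R , M -ᵥ R ⟫ + D² P M ≈ D² P R + D² R M
  chord-identity (p₁ , p₂) (r₁ , r₂) (m₁ , m₂) = solve 6 (λ p₁ p₂ r₁ r₂ m₁ m₂ →
    let P = (p₁ , p₂) ; R = (r₁ , r₂) ; M = (m₁ , m₂) in
    Poly.double Poly.⟪ P Poly.-ᵥ R , M Poly.-ᵥ R ⟫ :+ Poly.D² P M := Poly.D² P R :+ Poly.D² R M)
    refl p₁ p₂ r₁ r₂ m₁ m₂

  heron-identity : ∀ P Q R → Δ (D² P Q) (D² Q R) (D² P R) ≈ double (cross (P -ᵥ R) (Q -ᵥ R)) ²
  heron-identity (p₁ , p₂) (q₁ , q₂) (r₁ , r₂) = solve 6 (λ p₁ p₂ q₁ q₂ r₁ r₂ →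
    let P = (p₁ , p₂) ; Q = (q₁ , q₂) ; R = (r₁ , r₂) in
    Poly.Δ (Poly.D² P Q) (Poly.D² Q R) (Poly.D² P R)
      := Poly.double (Poly.cross (P Poly.-ᵥ R) (Q Poly.-ᵥ R)) Poly.²)
    refl p₁ p₂ q₁ q₂ r₁ r₂

  -- (u·w) v − (v·w) u is w rotated by a right angle and scaled by cross u v.
  cramer-identity : ∀ u v w →
    ‖ w ‖² * double (cross u v) ² ≈ ‖ double ⟪ u , w ⟫ ·ᵥ v -ᵥ double ⟪ v , w ⟫ ·ᵥ u ‖²
  cramer-identity (u₁ , u₂) (v₁ , v₂) (w₁ , w₂) = solve 6 (λ u₁ u₂ v₁ v₂ w₁ w₂ →
    let u = (u₁ , u₂) ; v = (v₁ , v₂) ; w = (w₁ , w₂) in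
    Poly.‖ w ‖² :* (Poly.double (Poly.cross u v) Poly.²)
      := Poly.‖ Poly.double Poly.⟪ u , w ⟫ Poly.·ᵥ v Poly.-ᵥ Poly.double Poly.⟪ v , w ⟫ Poly.·ᵥ u ‖²)
    refl u₁ u₂ v₁ v₂ w₁ w₂

  lagrange-identity : ∀ P Q R →
    ‖ D² P R ·ᵥ (Q -ᵥ R) -ᵥ D² Q R ·ᵥ (P -ᵥ R) ‖² ≈ D² P Q * D² Q R * D² P R
  lagrange-identity (p₁ , p₂) (q₁ , q₂) (r₁ , r₂) = solve 6 (λ p₁ p₂ q₁ q₂ r₁ r₂ →
    let P = (p₁ , p₂) ; Q = (q₁ , q₂) ; R = (r₁ , r₂) in
    Poly.‖ Poly.D² P R Poly.·ᵥ (Q Poly.-ᵥ R) Poly.-ᵥ Poly.D² Q R Poly.·ᵥ (P Poly.-ᵥ R) ‖²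
      := Poly.D² P Q :* Poly.D² Q R :* Poly.D² P R)
    refl p₁ p₂ q₁ q₂ r₁ r₂

  equidistance-identity : ∀ P Q R M →
    D² P R + D² Q M + double ⟪ P -ᵥ Q , R -ᵥ M ⟫ ≈ D² Q R + D² P M
  equidistance-identity (p₁ , p₂) (q₁ , q₂) (r₁ , r₂) (m₁ , m₂) = solve 8 (λ p₁ p₂ q₁ q₂ r₁ r₂ m₁ m₂ →
    let P = (p₁ , p₂) ; Q = (q₁ , q₂) ; R = (r₁ , r₂) ; M = (m₁ , m₂) in
    Poly.D² P R :+ Poly.D² Q M :+ Poly.double Poly.⟪ P Poly.-ᵥ Q , R Poly.-ᵥ M ⟫
      := Poly.D² Q R :+ Poly.D² P M)
    refl p₁ p₂ q₁ q₂ r₁ r₂ m₁ m₂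

  isotropic-identity₁ : ∀ d₁ d₂ w₁ w₂ →
    ‖ (w₁ , w₂) ‖² * d₁ ² ≈ ⟪ (d₁ , d₂) , (w₁ , w₂) ⟫ * (w₁ * d₁ - w₂ * d₂) + w₂ ² * ‖ (d₁ , d₂) ‖²
  isotropic-identity₁ = solve 4 (λ d₁ d₂ w₁ w₂ →
    Poly.‖ (w₁ , w₂) ‖² :* (d₁ Poly.²)
      := Poly.⟪ (d₁ , d₂) , (w₁ , w₂) ⟫ :* (w₁ :* d₁ :- w₂ :* d₂) :+ (w₂ Poly.²) :* Poly.‖ (d₁ , d₂) ‖²)
    refl

  isotropic-identity₂ : ∀ d₁ d₂ w₁ w₂ →
    ‖ (w₁ , w₂) ‖² * d₂ ² ≈ ⟪ (d₁ , d₂) , (w₁ , w₂) ⟫ * (w₂ * d₂ - w₁ * d₁) + w₁ ² * ‖ (d₁ , d₂) ‖²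
  isotropic-identity₂ = solve 4 (λ d₁ d₂ w₁ w₂ →
    Poly.‖ (w₁ , w₂) ‖² :* (d₂ Poly.²)
      := Poly.⟪ (d₁ , d₂) , (w₁ , w₂) ⟫ :* (w₂ :* d₂ :- w₁ :* d₁) :+ (w₁ Poly.²) :* Poly.‖ (d₁ , d₂) ‖²)
    refl

  Δ-degenerate-identity : ∀ a b c → (b - c) ² ≈ a * (double (b + c) - a) - Δ a b c
  Δ-degenerate-identity = solve 3 (λ a b c →
    (b :- c) Poly.² := a :* (Poly.double (b :+ c) :- a) :- Poly.Δ a b c)
    refl

  Δ-sides-rotate : ∀ P Q R → Δ (D² Q R) (D² R P) (D² Q P) ≈ Δ (D² P Q) (D² Q R) (D² P R)
  Δ-sides-rotate (p₁ , p₂) (q₁ , q₂) (r₁ , r₂) = solve 6 (λ p₁ p₂ q₁ q₂ r₁ r₂ →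
    let P = (p₁ , p₂) ; Q = (q₁ , q₂) ; R = (r₁ , r₂) in
    Poly.Δ (Poly.D² Q R) (Poly.D² R P) (Poly.D² Q P) := Poly.Δ (Poly.D² P Q) (Poly.D² Q R) (Poly.D² P R))
    refl p₁ p₂ q₁ q₂ r₁ r₂

  Δ-sides-swap : ∀ P Q R → Δ (D² P R) (D² R Q) (D² P Q) ≈ Δ (D² P Q) (D² Q R) (D² P R)
  Δ-sides-swap (p₁ , p₂) (q₁ , q₂) (r₁ , r₂) = solve 6 (λ p₁ p₂ q₁ q₂ r₁ r₂ →
    let P = (p₁ , p₂) ; Q = (q₁ , q₂) ; R = (r₁ , r₂) in
    Poly.Δ (Poly.D² P R) (Poly.D² R Q) (Poly.D² P Q) := Poly.Δ (Poly.D² P Q) (Poly.D² Q R) (Poly.D² P R))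
    refl p₁ p₂ q₁ q₂ r₁ r₂

  ²-cong : ∀ {x y} → x ≈ y → x ² ≈ y ²
  ²-cong x≈y = *-cong x≈y x≈y

  ‖·ᵥ-ᵥ·ᵥ‖²-cong : ∀ {s s′ t t′} u v → s ≈ s′ → t ≈ t′ →
    ‖ s ·ᵥ v -ᵥ t ·ᵥ u ‖² ≈ ‖ s′ ·ᵥ v -ᵥ t′ ·ᵥ u ‖²
  ‖·ᵥ-ᵥ·ᵥ‖²-cong u v s≈s′ t≈t′ =
    +-cong (²-cong (+-cong (*-congʳ s≈s′) (-‿cong (*-congʳ t≈t′))))
           (²-cong (+-cong (*-congʳ s≈s′) (-‿cong (*-congʳ t≈t′))))

  chord : ∀ {ρ} P R M → D² P M ≈ ρ → D² R M ≈ ρ → D² P R ≈ double ⟪ P -ᵥ R , M -ᵥ R ⟫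
  chord {ρ} P R M PM≈ρ RM≈ρ = sym (+-cancelʳ ρ _ _ (begin
    double ⟪ P -ᵥ R , M -ᵥ R ⟫ + ρ     ≈⟨ +-congˡ PM≈ρ ⟨
    double ⟪ P -ᵥ R , M -ᵥ R ⟫ + D² P M ≈⟨ chord-identity P R M ⟩
    D² P R + D² R M                     ≈⟨ +-congˡ RM≈ρ ⟩
    D² P R + ρ                          ∎))

  circumradius : ∀ {ρ} P Q R M → D² P M ≈ ρ → D² Q M ≈ ρ → D² R M ≈ ρ →
    ρ * Δ (D² P Q) (D² Q R) (D² P R) ≈ D² P Q * D² Q R * D² P R
  circumradius {ρ} P Q R M PM≈ρ QM≈ρ RM≈ρ = begin
    ρ * Δ (D² P Q) (D² Q R) (D² P R)
      ≈⟨ *-cong (trans (sym RM≈ρ) (D²-comm R M)) (heron-identity P Q R) ⟩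
    ‖ w ‖² * double (cross u v) ²
      ≈⟨ cramer-identity u v w ⟩
    ‖ double ⟪ u , w ⟫ ·ᵥ v -ᵥ double ⟪ v , w ⟫ ·ᵥ u ‖²
      ≈⟨ ‖·ᵥ-ᵥ·ᵥ‖²-cong u v (chord P R M PM≈ρ RM≈ρ) (chord Q R M QM≈ρ RM≈ρ) ⟨
    ‖ D² P R ·ᵥ v -ᵥ D² Q R ·ᵥ u ‖²
      ≈⟨ lagrange-identity P Q R ⟩
    D² P Q * D² Q R * D² P R ∎
    where
    u = P -ᵥ R
    v = Q -ᵥ R
    w = M -ᵥ R

  equidistant⇒orthogonal : CharNot2 → ∀ P Q R M → D² P M ≈ D² Q M → D² P R ≈ D² Q R →
    ⟪ P -ᵥ Q , R -ᵥ M ⟫ ≈ 0#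
  equidistant⇒orthogonal char≢2 P Q R M PM≈QM PR≈QR =
    x+x≈0⇒x≈0 char≢2 (+-identityʳ-unique (D² Q R + D² P M) _ (begin
      D² Q R + D² P M + double ⟪ P -ᵥ Q , R -ᵥ M ⟫
        ≈⟨ +-congʳ (+-cong PR≈QR (sym PM≈QM)) ⟨
      D² P R + D² Q M + double ⟪ P -ᵥ Q , R -ᵥ M ⟫
        ≈⟨ equidistance-identity P Q R M ⟩
      D² Q R + D² P M ∎))

  isotropic⊥anisotropic⇒¬¬zero : ∀ d w → ‖ d ‖² ≈ 0# → ⟪ d , w ⟫ ≈ 0# → ¬ ‖ w ‖² ≈ 0# →
    ¬ ¬ (d ≈ᴾ (0# , 0#))
  isotropic⊥anisotropic⇒¬¬zero (d₁ , d₂) (w₁ , w₂) d≈0 d⊥w w≉0 d≉0 =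
    x*x≈0⇒¬¬x≈0 (x≉0⇒x*y≈0⇒y≈0 w≉0 (trans (isotropic-identity₁ d₁ d₂ w₁ w₂) (vanishes _ _))) λ d₁≈0 →
    x*x≈0⇒¬¬x≈0 (x≉0⇒x*y≈0⇒y≈0 w≉0 (trans (isotropic-identity₂ d₁ d₂ w₁ w₂) (vanishes _ _))) λ d₂≈0 →
    d≉0 (d₁≈0 , d₂≈0)
    where
    vanishes : ∀ x y → ⟪ (d₁ , d₂) , (w₁ , w₂) ⟫ * x + y * ‖ (d₁ , d₂) ‖² ≈ 0#
    vanishes x y = trans (+-cong (trans (*-congʳ d⊥w) (zeroˡ x)) (trans (*-congˡ d≈0) (zeroʳ y))) (+-identityʳ 0#)

  squaredSide≉0 : CharNot2 → ∀ {r} → ¬ r ≈ 0# → ∀ P Q R M →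
    OnCircle M r P → OnCircle M r Q → OnCircle M r R → ¬ P ≈ᴾ Q →
    Δ (D² P Q) (D² Q R) (D² P R) ≈ 0# → ¬ D² P Q ≈ 0#
  squaredSide≉0 char≢2 r≉0 P Q R M onP onQ onR P≉Q Δ≈0 PQ≈0 =
    x*x≈0⇒¬¬x≈0 equal-sides λ QR-PR≈0 →
    isotropic⊥anisotropic⇒¬¬zero (P -ᵥ Q) (R -ᵥ M) PQ≈0
      (equidistant⇒orthogonal char≢2 P Q R M (trans onP (sym onQ)) (sym (x∙y⁻¹≈ε⇒x≈y _ _ QR-PR≈0)))
      RM≉0
      λ (p₁-q₁≈0 , p₂-q₂≈0) → P≉Q (x∙y⁻¹≈ε⇒x≈y _ _ p₁-q₁≈0 , x∙y⁻¹≈ε⇒x≈y _ _ p₂-q₂≈0)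
    where
    equal-sides : (D² Q R - D² P R) ² ≈ 0#
    equal-sides = begin
      (D² Q R - D² P R) ²
        ≈⟨ Δ-degenerate-identity (D² P Q) (D² Q R) (D² P R) ⟩
      D² P Q * (double (D² Q R + D² P R) - D² P Q) - Δ (D² P Q) (D² Q R) (D² P R)
        ≈⟨ +-cong (trans (*-congʳ PQ≈0) (zeroˡ _)) (trans (-‿cong Δ≈0) -0#≈0#) ⟩
      0# + 0#
        ≈⟨ +-identityʳ 0# ⟩
      0# ∎
    RM≉0 : ¬ ‖ R -ᵥ M ‖² ≈ 0#
    RM≉0 RM≈0 = x≉0∧y≉0⇒x*y≉0 r≉0 r≉0 (trans (sym onR) RM≈0)

  Δ-sides≉0 : CharNot2 → ∀ {r} → ¬ r ≈ 0# → ∀ P Q R M →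
    OnCircle M r P → OnCircle M r Q → OnCircle M r R →
    ¬ P ≈ᴾ Q → ¬ P ≈ᴾ R → ¬ Q ≈ᴾ R →
    ¬ Δ (D² P Q) (D² Q R) (D² P R) ≈ 0#
  Δ-sides≉0 char≢2 {r} r≉0 P Q R M onP onQ onR P≉Q P≉R Q≉R Δ≈0 =
    x≉0∧y≉0⇒x*y≉0 (x≉0∧y≉0⇒x*y≉0 PQ≉0 QR≉0) PR≉0 (begin
      D² P Q * D² Q R * D² P R            ≈⟨ circumradius P Q R M onP onQ onR ⟨
      r * r * Δ (D² P Q) (D² Q R) (D² P R) ≈⟨ *-congˡ Δ≈0 ⟩
      r * r * 0#                            ≈⟨ zeroʳ (r * r) ⟩
      0#                                    ∎)
    where
    PQ≉0 = squaredSide≉0 char≢2 r≉0 P Q R M onP onQ onR P≉Q Δ≈0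
    QR≉0 = squaredSide≉0 char≢2 r≉0 Q R P M onQ onR onP Q≉R (trans (Δ-sides-rotate P Q R) Δ≈0)
    PR≉0 = squaredSide≉0 char≢2 r≉0 P R Q M onP onR onQ P≉R (trans (Δ-sides-swap P Q R) Δ≈0)

module PrimeSubfield {c ℓ} (F : Field c ℓ) where
  open FieldNotions F
  open FieldProperties F
  open IntegerCast F using (intCast-+; intCast-*; intCast-neg)
  open RingSolver F using (solve; _:=_; _:+_; _:*_)
  open PlaneFormulas rawRing using (Δ)
  open import Relation.Binary.Reasoning.Setoid setoid
  open import Algebra.Properties.CommutativeSemigroup *-commutativeSemigroup using (interchange)

  intCast-*-≉0 : ∀ i j → ¬ intCast i ≈ 0# → ¬ intCast j ≈ 0# → ¬ intCast (i ℤ.* j) ≈ 0#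
  intCast-*-≉0 i j i≉0 j≉0 ij≈0 = x≉0∧y≉0⇒x*y≉0 i≉0 j≉0 (trans (sym (intCast-* i j)) ij≈0)

  resp : ∀ {x y} → x ≈ y → InPrimeSubfield x → InPrimeSubfield y
  resp x≈y (a , b , b≉0 , xb≈a) = a , b , b≉0 , trans (*-congʳ (sym x≈y)) xb≈a

  *-closed : ∀ {x y} → InPrimeSubfield x → InPrimeSubfield y → InPrimeSubfield (x * y)
  *-closed {x} {y} (a , b , b≉0 , xb≈a) (a′ , b′ , b′≉0 , yb′≈a′) =
    a ℤ.* a′ , b ℤ.* b′ , intCast-*-≉0 b b′ b≉0 b′≉0 , (begin
      x * y * intCast (b ℤ.* b′)              ≈⟨ *-congˡ (intCast-* b b′) ⟩
      x * y * (intCast b * intCast b′)        ≈⟨ interchange x y (intCast b) (intCast b′) ⟩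
      x * intCast b * (y * intCast b′)        ≈⟨ *-cong xb≈a yb′≈a′ ⟩
      intCast a * intCast a′                  ≈⟨ intCast-* a a′ ⟨
      intCast (a ℤ.* a′)                      ∎)

  +-closed : ∀ {x y} → InPrimeSubfield x → InPrimeSubfield y → InPrimeSubfield (x + y)
  +-closed {x} {y} (a , b , b≉0 , xb≈a) (a′ , b′ , b′≉0 , yb′≈a′) =
    a ℤ.* b′ ℤ.+ a′ ℤ.* b , b ℤ.* b′ , intCast-*-≉0 b b′ b≉0 b′≉0 , (begin
      (x + y) * intCast (b ℤ.* b′)
        ≈⟨ *-congˡ (intCast-* b b′) ⟩
      (x + y) * (intCast b * intCast b′)
        ≈⟨ solve 4 (λ x y u v → (x :+ y) :* (u :* v) := x :* u :* v :+ y :* v :* u) refl x y (intCast b) (intCast b′) ⟩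
      x * intCast b * intCast b′ + y * intCast b′ * intCast b
        ≈⟨ +-cong (*-congʳ xb≈a) (*-congʳ yb′≈a′) ⟩
      intCast a * intCast b′ + intCast a′ * intCast b
        ≈⟨ +-cong (intCast-* a b′) (intCast-* a′ b) ⟨
      intCast (a ℤ.* b′) + intCast (a′ ℤ.* b)
        ≈⟨ intCast-+ (a ℤ.* b′) (a′ ℤ.* b) ⟨
      intCast (a ℤ.* b′ ℤ.+ a′ ℤ.* b) ∎)

  -‿closed : ∀ {x} → InPrimeSubfield x → InPrimeSubfield (- x)
  -‿closed {x} (a , b , b≉0 , xb≈a) = ℤ.- a , b , b≉0 , (begin
    - x * intCast b     ≈⟨ -‿distribˡ-* x (intCast b) ⟨
    - (x * intCast b)   ≈⟨ -‿cong xb≈a ⟩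
    - intCast a         ≈⟨ intCast-neg a ⟨
    intCast (ℤ.- a)     ∎)
    where open import Algebra.Properties.Ring ring using (-‿distribˡ-*)

  Δ-closed : ∀ {a b c} → InPrimeSubfield a → InPrimeSubfield b → InPrimeSubfield c →
    InPrimeSubfield (Δ a b c)
  Δ-closed a∈ b∈ c∈ =
    sub (sub (sub (+-closed (+-closed (double (*-closed a∈ b∈)) (double (*-closed b∈ c∈)))
                            (double (*-closed c∈ a∈)))
                  (square a∈))
             (square b∈))
        (square c∈)
    where
    double : ∀ {x} → InPrimeSubfield x → InPrimeSubfield (x + x)
    double x∈ = +-closed x∈ x∈
    square : ∀ {x} → InPrimeSubfield x → InPrimeSubfield (x * x)
    square x∈ = *-closed x∈ x∈
    sub : ∀ {x y} → InPrimeSubfield x → InPrimeSubfield y → InPrimeSubfield (x - y)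
    sub x∈ y∈ = +-closed x∈ (-‿closed y∈)

  squares⊆ : ∀ {x} → InSquaresOfPrimeSubfield x → InPrimeSubfield x
  squares⊆ (t , t∈ , x≈t*t) = resp (sym x≈t*t) (*-closed t∈ t∈)

  quotient-closed : ∀ {x y z} → InPrimeSubfield y → InPrimeSubfield z → ¬ y ≈ 0# → x * y ≈ z →
    InPrimeSubfield x
  quotient-closed {x} {y} {z} (a , b , b≉0 , yb≈a) (a′ , b′ , b′≉0 , zb′≈a′) y≉0 xy≈z =
    a′ ℤ.* b , a ℤ.* b′ , intCast-*-≉0 a b′ a≉0 b′≉0 , (begin
      x * intCast (a ℤ.* b′)              ≈⟨ *-congˡ (intCast-* a b′) ⟩
      x * (intCast a * intCast b′)        ≈⟨ *-congˡ (*-congʳ yb≈a) ⟨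
      x * (y * intCast b * intCast b′)    ≈⟨ solve 4 (λ x y u v → x :* (y :* u :* v) := x :* y :* v :* u) refl x y (intCast b) (intCast b′) ⟩
      x * y * intCast b′ * intCast b      ≈⟨ *-congʳ (*-congʳ xy≈z) ⟩
      z * intCast b′ * intCast b          ≈⟨ *-congʳ zb′≈a′ ⟩
      intCast a′ * intCast b              ≈⟨ intCast-* a′ b ⟨
      intCast (a′ ℤ.* b)                  ∎)
    where
    a≉0 : ¬ intCast a ≈ 0#
    a≉0 a≈0 = y≉0 (x≉0⇒x*y≈0⇒y≈0 b≉0 (trans (*-comm (intCast b) y) (trans yb≈a a≈0)))

mainTheorem17 : {c ℓ : Level} (F : Field c ℓ) →
    let open FieldNotions F in
    CharNot2 → (M : Point) (r : Carrier) → ¬ (r ≈ 0#) →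
    Σ (Point → Set (c ⊔ ℓ)) (λ S → CircularPointSetIn M r S × HasAtLeast3 S) →
    InPrimeSubfield (r * r)
mainTheorem17 F char≢2 M r r≉0
  (S , (onCircle , squareDistances) , P , Q , R , P∈S , Q∈S , R∈S , P≉Q , P≉R , Q≉R) =
  quotient-closed (Δ-closed PQ∈ QR∈ PR∈) (*-closed (*-closed PQ∈ QR∈) PR∈)
    (Δ-sides≉0 char≢2 r≉0 P Q R M onP onQ onR P≉Q P≉R Q≉R)
    (circumradius P Q R M onP onQ onR)
  where
  open CircleGeometry F using (circumradius; Δ-sides≉0)
  open PrimeSubfield F using (quotient-closed; Δ-closed; *-closed; squares⊆)
  onP = onCircle P P∈S
  onQ = onCircle Q Q∈S
  onR = onCircle R R∈S
  PQ∈ = squares⊆ (squareDistances P Q P∈S Q∈S)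
  QR∈ = squares⊆ (squareDistances Q R Q∈S R∈S)
  PR∈ = squares⊆ (squareDistances P R P∈S R∈S)
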